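{- Let $n,m\in\mathbb{N}$, let $G$ be the $n\times m$ grid, let $s,t$ be two distinct vertices of $G$, and let $p,k\in\mathbb{N}$. If $m<p$ and $n<p$, then the Minimum Shared Edges instance $(G,s,t,p,k)$ has a solution if and only if $\mathrm{dist}_G(s,t)\le k$.
   Context: The $n\times m$ grid is the undirected graph with vertex set $\{(x,y)\in\mathbb{N}\times\mathbb{N} : x<n,\ y<m\}$ and an edge between $(v,w)$ and $(x,y)$ iff $|v-x|+|w-y|=1$. Minimum Shared Edges (MSE): given an undirected graph $G$, distinct vertices $s,t$ and integers $k,p\in\mathbb{N}$, a solution is a multiset of $p$ paths $P_1,\dots,P_p$ from $s$ to $t$ (a path is a set of edges $\{\{v_{i-1},v_i\}:0<i\le n\}$ for pairwise distinct vertices $v_0,\dots,v_n$) such that the number of edges lying in at least two of the paths (the shared edges) is at most $k$. $\mathrm{dist}_G(s,t)$ is the length (number of edges) of a shortest $s$-$t$ path. -}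

module Defs where

open import Data.Nat using (ℕ; suc; _≤_; ∣_-_∣; _+_)
open import Data.Fin using (Fin; toℕ)
open import Data.Product using (_×_; _,_; proj₁; proj₂; Σ; ∃; ∃-syntax)
open import Data.Sum using (_⊎_)
open import Data.List using (List; []; _∷_; length)
open import Data.List.Relation.Unary.Unique.Propositional using (Unique)
open import Data.List.Membership.Propositional using (_∈_)
open import Relation.Binary.PropositionalEquality using (_≡_; _≢_)

Vertex : ℕ → ℕ → Set
Vertex n m = Fin n × Fin m

record Adj {n m : ℕ} (a b : Vertex n m) : Set where
  constructor adj
  field
    isAdj : ∣ toℕ (proj₁ a) - toℕ (proj₁ b) ∣ + ∣ toℕ (proj₂ a) - toℕ (proj₂ b) ∣ ≡ 1

data Walk {n m : ℕ} : Vertex n m → Vertex n m → Set where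
  done : ∀ {v} → Walk v v
  step : ∀ {u w v} → Adj u w → Walk w v → Walk u v

vertices : ∀ {n m} {u v : Vertex n m} → Walk u v → List (Vertex n m)
vertices {u = u} done = u ∷ []
vertices {u = u} (step _ W) = u ∷ vertices W

len : ∀ {n m} {u v : Vertex n m} → Walk u v → ℕ
len done = 0
len (step _ W) = suc (len W)

record Path {n m : ℕ} (s t : Vertex n m) : Set where
  constructor mkPath
  field
    walk     : Walk s t
    distinct : Unique (vertices walk)
open Path public

data EdgeOfWalk {n m : ℕ} (a b : Vertex n m) : {u v : Vertex n m} → Walk u v → Set where
  here-fwd  : ∀ {w v} (e : Adj a w) (W : Walk w v) → w ≡ b → EdgeOfWalk a b (step e W)
  here-bwd  : ∀ {u w v} (e : Adj u w) (W : Walk w v) → u ≡ b → w ≡ a → EdgeOfWalk a b (step e W)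
  there     : ∀ {u w v} (e : Adj u w) (W : Walk w v) → EdgeOfWalk a b W → EdgeOfWalk a b (step e W)

EdgeOf : ∀ {n m} {s t : Vertex n m} → Vertex n m → Vertex n m → Path s t → Set
EdgeOf a b P = EdgeOfWalk a b (walk P)

Shared : ∀ {n m p} {s t : Vertex n m} → (Fin p → Path s t) → Vertex n m → Vertex n m → Set
Shared P a b = ∃[ i ] ∃[ j ] (i ≢ j × EdgeOf a b (P i) × EdgeOf a b (P j))

-- the number of shared edges is at most k: all shared (undirected) edges
-- are listed in a list of at most k (ordered) vertex pairs
AtMostShared : ∀ {n m p} {s t : Vertex n m} → (Fin p → Path s t) → ℕ → Set
AtMostShared {n} {m} P k =
  Σ (List (Vertex n m × Vertex n m)) λ L →
    length L ≤ k ×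
    (∀ a b → Shared P a b → ((a , b) ∈ L) ⊎ ((b , a) ∈ L))

MSESolvable : (n m : ℕ) → Vertex n m → Vertex n m → (p k : ℕ) → Set
MSESolvable n m s t p k = Σ (Fin p → Path s t) λ P → AtMostShared P k

IsDist : ∀ {n m} → Vertex n m → Vertex n m → ℕ → Set
IsDist s t d = (Σ (Path s t) λ P → len (walk P) ≡ d) × (∀ (P : Path s t) → d ≤ len (walk P))

-- If d ≤ k, p copies of a shortest path share only its d edges.  Conversely, let D = |Δx| + |Δy| be
-- the Manhattan distance of s and t; a walk that decreases the Manhattan distance to t at every step
-- is a path of length D, so d ≤ D.  Every s–t path crosses each of the |Δx| boundaries
-- x = c | x = c + 1 strictly between s and t along an edge that keeps y; y takes only m < p values, so
-- two of the p paths cross it along the same edge, which is therefore shared.  The same holds for the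
-- |Δy| boundaries in y, as n < p.  These D shared edges are pairwise distinct, so D ≤ k.
module Submission where

open import Defs
open import Data.Nat using (ℕ; zero; suc; _<_; _≤_; _≤?_; _<?_; _+_; _⊓_; ∣_-_∣; z≤n; s≤s)
open import Data.Nat.Properties
open import Data.Fin using (Fin; toℕ; fromℕ<; splitAt; join)
open import Data.Fin.Properties using (toℕ-injective; toℕ<n; toℕ-fromℕ<; pigeonhole; injective⇒≤; join-splitAt)
open import Data.Product using (_×_; _,_; proj₁; proj₂; Σ; ∃₂; ∃-syntax)
open import Data.Sum using (_⊎_; inj₁; inj₂; [_,_])
open import Data.List using (List; []; _∷_; length; lookup)
open import Data.List.Relation.Unary.Any using (here; there)
open import Data.List.Relation.Unary.Any.Properties using (lookup-index)
open import Data.List.Relation.Unary.All as All using (All; []; _∷_)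
open import Data.List.Relation.Unary.AllPairs using ([]; _∷_)
open import Data.List.Relation.Unary.Unique.Propositional using (Unique)
open import Data.List.Membership.Propositional using (_∈_)
open import Function.Definitions using (Injective)
open import Relation.Nullary using (¬_; yes; no; contradiction)
open import Relation.Unary using (Decidable)
open import Relation.Binary.PropositionalEquality hiding ([_])

step-towards : ∀ x y {k} → ∣ x - y ∣ ≡ suc k →
               ∃[ x′ ] ∣ x - x′ ∣ ≡ 1 × ∣ x′ - y ∣ ≡ k × (x′ ≤ x ⊎ x′ ≤ y)
step-towards zero    (suc y) refl = 1 , refl , refl , inj₂ (s≤s z≤n)
step-towards (suc x) zero    refl =
  x , trans (m≤n⇒∣n-m∣≡n∸m (n≤1+n x)) (m+n∸n≡m 1 x) , ∣-∣-identityʳ x , inj₁ (n≤1+n x)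
step-towards (suc x) (suc y) eq with step-towards x y eq
... | x′ , one , rest , inj₁ x′≤x = suc x′ , one , rest , inj₁ (s≤s x′≤x)
... | x′ , one , rest , inj₂ x′≤y = suc x′ , one , rest , inj₂ (s≤s x′≤y)

step-towardsFin : ∀ {N} (a b : Fin N) {k} → ∣ toℕ a - toℕ b ∣ ≡ suc k →
                  ∃[ a′ ] ∣ toℕ a - toℕ a′ ∣ ≡ 1 × ∣ toℕ a′ - toℕ b ∣ ≡ k
step-towardsFin a b eq with step-towards (toℕ a) (toℕ b) eq
... | x′ , one , rest , x′≤a⊎x′≤b =
  fromℕ< x′<N , subst (λ z → ∣ toℕ a - z ∣ ≡ 1) (sym (toℕ-fromℕ< x′<N)) one ,
                subst (λ z → ∣ z - toℕ b ∣ ≡ _) (sym (toℕ-fromℕ< x′<N)) rest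
  where
  x′<N = [ (λ x′≤a → ≤-<-trans x′≤a (toℕ<n a)) , (λ x′≤b → ≤-<-trans x′≤b (toℕ<n b)) ] x′≤a⊎x′≤b

m<n⇒∣m-n∣+o≡1⇒n≡1+m×o≡0 : ∀ {x y z} → x < y → ∣ x - y ∣ + z ≡ 1 → y ≡ suc x × z ≡ 0
m<n⇒∣m-n∣+o≡1⇒n≡1+m×o≡0 {zero} {suc y} _ eq =
  cong suc (m+n≡0⇒m≡0 y (suc-injective eq)) , m+n≡0⇒n≡0 y (suc-injective eq)
m<n⇒∣m-n∣+o≡1⇒n≡1+m×o≡0 {suc x} {suc y} (s≤s x<y) eq =
  let (y≡1+x , z≡0) = m<n⇒∣m-n∣+o≡1⇒n≡1+m×o≡0 x<y eq in cong suc y≡1+x , z≡0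

Between : ℕ → ℕ → ℕ → Set
Between x y c = (x ≤ c × c < y) ⊎ (y ≤ c × c < x)

between-⊓+ : ∀ x y {j} → j < ∣ x - y ∣ → Between x y (x ⊓ y + j)
between-⊓+ zero    y       j<y = inj₁ (z≤n , j<y)
between-⊓+ (suc x) zero    j<x = inj₂ (z≤n , j<x)
between-⊓+ (suc x) (suc y) j<∣x-y∣ with between-⊓+ x y j<∣x-y∣
... | inj₁ (x≤c , c<y) = inj₁ (s≤s x≤c , s≤s c<y)
... | inj₂ (y≤c , c<x) = inj₂ (s≤s y≤c , s≤s c<x)

injective-into-list : ∀ {A : Set} {d} {L : List A} (f : Fin d → A) →
                      (∀ i → f i ∈ L) → Injective _≡_ _≡_ f → d ≤ length L
injective-into-list {L = L} f f∈L f-injective = injective⇒≤ λ {i} {j} same-index →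
  f-injective (trans (lookup-index (f∈L i)) (trans (cong (lookup L) same-index) (sym (lookup-index (f∈L j)))))

splitAt-injective : ∀ a {b} → Injective _≡_ _≡_ (splitAt a {b})
splitAt-injective a {b} {i} {j} eq = trans (sym (join-splitAt a b i)) (trans (cong (join a b) eq) (join-splitAt a b j))

module _ {n m : ℕ} where

  X Y : Vertex n m → ℕ
  X v = toℕ (proj₁ v)
  Y v = toℕ (proj₂ v)

  manhattan : Vertex n m → Vertex n m → ℕ
  manhattan u v = ∣ X u - X v ∣ + ∣ Y u - Y v ∣

  manhattan≡0⇒≡ : {u v : Vertex n m} → manhattan u v ≡ 0 → u ≡ v
  manhattan≡0⇒≡ {u} eq = cong₂ _,_
    (toℕ-injective (∣m-n∣≡0⇒m≡n (m+n≡0⇒m≡0 _ eq)))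
    (toℕ-injective (∣m-n∣≡0⇒m≡n (m+n≡0⇒n≡0 ∣ X u - _ ∣ eq)))

  closerNeighbour : (u t : Vertex n m) {k : ℕ} → manhattan u t ≡ suc k →
                    ∃[ w ] Adj u w × manhattan w t ≡ k
  closerNeighbour u@(x , y) t eq with ∣ X u - X t ∣ in dx
  ... | zero with step-towardsFin y (proj₂ t) eq
  ...   | y′ , one , rest =
    (x , y′) , adj (trans (cong (_+ _) (∣n-n∣≡0 (X u))) one) , trans (cong (_+ _) dx) rest
  closerNeighbour u@(x , y) t eq | suc j with step-towardsFin x (proj₁ t) dx
  ...   | x′ , one , rest =
    (x′ , y) , adj (trans (cong (_ +_) (∣n-n∣≡0 (Y u))) (trans (+-identityʳ _) one)) ,
    trans (cong (_+ _) rest) (suc-injective eq)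

  descent : (t : Vertex n m) (k : ℕ) (u : Vertex n m) → manhattan u t ≡ k →
            Σ (Walk u t) λ W → len W ≡ k × All (λ v → manhattan v t ≤ k) (vertices W) × Unique (vertices W)
  descent t zero u eq with manhattan≡0⇒≡ {u} {t} eq
  ... | refl = done , refl , ≤-reflexive eq ∷ [] , [] ∷ []
  descent t (suc k) u eq with closerNeighbour u t eq
  ... | w , u~w , dw with descent t k w dw
  ...   | W , lenW , below , unique =
    step u~w W , cong suc lenW , ≤-reflexive eq ∷ All.map m≤n⇒m≤1+n below ,
    All.map (λ dv u≡v → 1+n≰n (subst (_≤ k) eq (subst (λ z → manhattan z t ≤ k) (sym u≡v) dv))) below
    ∷ unique

  dist≤manhattan : {s t : Vertex n m} {d : ℕ} → (∀ (P : Path s t) → d ≤ len (walk P)) → d ≤ manhattan s t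
  dist≤manhattan {s} {t} shortest with descent t (manhattan s t) s refl
  ... | W , lenW , _ , unique = subst (_ ≤_) lenW (shortest (mkPath W unique))

  Adj-sym : {a b : Vertex n m} → Adj a b → Adj b a
  Adj-sym {a} {b} (adj eq) = adj (trans (cong₂ _+_ (∣-∣-comm (X b) (X a)) (∣-∣-comm (Y b) (Y a))) eq)

  EdgeOfWalk-sym : {a b u v : Vertex n m} {W : Walk u v} → EdgeOfWalk a b W → EdgeOfWalk b a W
  EdgeOfWalk-sym (here-fwd e W w≡b) = here-bwd e W refl w≡b
  EdgeOfWalk-sym (here-bwd e W refl w≡a) = here-fwd e W w≡a
  EdgeOfWalk-sym (there e W E) = there e W (EdgeOfWalk-sym E)

  crossing : {u v : Vertex n m} (Q : Vertex n m → Set) → Decidable Q → (W : Walk u v) → Q u → ¬ Q v →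
             ∃₂ λ a b → Q a × ¬ Q b × Adj a b × EdgeOfWalk a b W
  crossing Q Q? done Qu ¬Qv = contradiction Qu ¬Qv
  crossing {u = u} Q Q? (step {w = w} e W) Qu ¬Qv with Q? w
  ... | yes Qw = let (a , b , Qa , ¬Qb , a~b , E) = crossing Q Q? W Qw ¬Qv
                 in a , b , Qa , ¬Qb , a~b , there e W E
  ... | no ¬Qw = u , w , Qu , ¬Qw , e , here-fwd e W refl

  edges : {u v : Vertex n m} → Walk u v → List (Vertex n m × Vertex n m)
  edges done = []
  edges {u = u} (step {w = w} _ W) = (u , w) ∷ edges W

  length-edges : {u v : Vertex n m} (W : Walk u v) → length (edges W) ≡ len W
  length-edges done = refl
  length-edges (step _ W) = cong suc (length-edges W)

  EdgeOfWalk⇒∈edges : {a b u v : Vertex n m} {W : Walk u v} → EdgeOfWalk a b W →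
                      (a , b) ∈ edges W ⊎ (b , a) ∈ edges W
  EdgeOfWalk⇒∈edges (here-fwd _ _ refl) = inj₁ (here refl)
  EdgeOfWalk⇒∈edges (here-bwd _ _ refl refl) = inj₂ (here refl)
  EdgeOfWalk⇒∈edges (there _ _ E) with EdgeOfWalk⇒∈edges E
  ... | inj₁ ab = inj₁ (there ab)
  ... | inj₂ ba = inj₂ (there ba)

copies-solvable : ∀ {n m} {s t : Vertex n m} p {k} (P : Path s t) → len (walk P) ≤ k → MSESolvable n m s t p k
copies-solvable p P P≤k =
  (λ _ → P) , edges (walk P) , subst (_≤ _) (sym (length-edges (walk P))) P≤k ,
  λ { a b (_ , _ , _ , E , _) → EdgeOfWalk⇒∈edges E }

Covers : ∀ {n m p} {s t : Vertex n m} → (Fin p → Path s t) → List (Vertex n m × Vertex n m) → Set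
Covers P L = ∀ a b → Shared P a b → (a , b) ∈ L ⊎ (b , a) ∈ L

-- Coordinates (level, line) in which adjacency is a unit step: (x, y) for columns, (y, x) for rows.
record Axis (n m : ℕ) : Set where
  field
    width : ℕ
    level : Vertex n m → ℕ
    line  : Vertex n m → Fin width
    manhattan-split      : ∀ a b → manhattan a b ≡ ∣ level a - level b ∣ + ∣ toℕ (line a) - toℕ (line b) ∣
    level-line-injective : ∀ {a b} → level a ≡ level b → line a ≡ line b → a ≡ b

columns rows : ∀ {n m} → Axis n m
columns {m = m} = record
  { width = m ; level = X ; line = proj₂
  ; manhattan-split = λ _ _ → refl
  ; level-line-injective = λ same-level same-line → cong₂ _,_ (toℕ-injective same-level) same-line
  }
rows {n = n} = record
  { width = n ; level = Y ; line = proj₁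
  ; manhattan-split = λ a b → +-comm ∣ X a - X b ∣ _
  ; level-line-injective = λ same-level same-line → cong₂ _,_ same-line (toℕ-injective same-level)
  }

module Crossings {n m : ℕ} (A : Axis n m) where
  open Axis A

  Crosses : ℕ → Vertex n m × Vertex n m → Set
  Crosses c (a , b) = level a ⊓ level b ≡ c × level a ≢ level b × line a ≡ line b

  Crosses-sym : ∀ {a b c} → Crosses c (a , b) → Crosses c (b , a)
  Crosses-sym {a} {b} (lower , different-level , same-line) =
    trans (⊓-comm (level b) (level a)) lower , (λ eq → different-level (sym eq)) , sym same-line

  Crosses-level : ∀ {c c′ e} → Crosses c e → Crosses c′ e → c ≡ c′
  Crosses-level (lower , _) (lower′ , _) = trans (sym lower) lower′

  record Crossing {u v : Vertex n m} (W : Walk u v) (c : ℕ) : Set where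
    field
      lower upper : Vertex n m
      edge        : EdgeOfWalk lower upper W
      lower-level : level lower ≡ c
      upper-level : level upper ≡ suc c
      same-line   : line lower ≡ line upper

  open Crossing

  crosses : ∀ {u v c} {W : Walk u v} (κ : Crossing W c) → Crosses c (lower κ , upper κ)
  crosses {c = c} κ =
    trans (cong₂ _⊓_ (lower-level κ) (upper-level κ)) (m≤n⇒m⊓n≡m (n≤1+n c)) ,
    (λ same-level → 1+n≢n (sym (trans (sym (lower-level κ)) (trans same-level (upper-level κ))))) ,
    same-line κ

  Crossing-unique : ∀ {u v u′ v′ c} {W : Walk u v} {W′ : Walk u′ v′} (κ : Crossing W c) (κ′ : Crossing W′ c) →
                    line (lower κ) ≡ line (lower κ′) → lower κ ≡ lower κ′ × upper κ ≡ upper κ′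
  Crossing-unique κ κ′ same =
    level-line-injective (trans (lower-level κ) (sym (lower-level κ′))) same ,
    level-line-injective (trans (upper-level κ) (sym (upper-level κ′)))
                         (trans (sym (same-line κ)) (trans same (same-line κ′)))

  adjacent-across : ∀ {a b c} → Adj a b → level a ≤ c → c < level b →
                    level a ≡ c × level b ≡ suc c × line a ≡ line b
  adjacent-across {a} {b} {c} (adj unit) a≤c c<b
    with m<n⇒∣m-n∣+o≡1⇒n≡1+m×o≡0 (≤-<-trans a≤c c<b) (trans (sym (manhattan-split a b)) unit)
  ... | b≡1+a , same-line =
    let a≡c = ≤-antisym a≤c (≤-pred (subst (suc c ≤_) b≡1+a c<b))
    in a≡c , trans b≡1+a (cong suc a≡c) , toℕ-injective (∣m-n∣≡0⇒m≡n same-line)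

  walk-crosses : ∀ {u v c} (W : Walk u v) → Between (level u) (level v) c → Crossing W c
  walk-crosses {c = c} W (inj₁ (u≤c , c<v)) =
    let (a , b , a≤c , b≰c , a~b , E) = crossing (λ x → level x ≤ c) (λ x → level x ≤? c) W u≤c (<⇒≱ c<v)
        (a≡c , b≡1+c , same) = adjacent-across a~b a≤c (≰⇒> b≰c)
    in record { lower = a ; upper = b ; edge = E
              ; lower-level = a≡c ; upper-level = b≡1+c ; same-line = same }
  walk-crosses {c = c} W (inj₂ (v≤c , c<u)) =
    let (a , b , c<a , c≮b , a~b , E) = crossing (λ x → c < level x) (λ x → c <? level x) W c<u (≤⇒≯ v≤c)
        (b≡c , a≡1+c , same) = adjacent-across (Adj-sym a~b) (≮⇒≥ c≮b) c<a
    in record { lower = b ; upper = a ; edge = EdgeOfWalk-sym E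
              ; lower-level = b≡c ; upper-level = a≡1+c ; same-line = same }

  -- Pigeonhole: there are more paths than lines, so two of them cross level c on the same line.
  shared-crossing : ∀ {p} {s t : Vertex n m} {c} → width < p → (P : Fin p → Path s t) →
                    Between (level s) (level t) c → ∃₂ λ a b → Shared P a b × Crosses c (a , b)
  shared-crossing width<p P between =
    let κ = λ i → walk-crosses (walk (P i)) between
        (i , j , i<j , same) = pigeonhole width<p (λ i → line (lower (κ i)))
        (same-lower , same-upper) = Crossing-unique (κ j) (κ i) (sym same)
    in lower (κ i) , upper (κ i) ,
       (i , j , (λ i≡j → <-irrefl (cong toℕ i≡j) i<j) , edge (κ i) ,
        subst₂ (λ a b → EdgeOfWalk a b (walk (P j))) same-lower same-upper (edge (κ j))) ,
       crosses (κ i)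

  covered-crossing : ∀ {p} {s t : Vertex n m} {c L} → width < p → (P : Fin p → Path s t) → Covers P L →
                     Between (level s) (level t) c → ∃[ e ] e ∈ L × Crosses c e
  covered-crossing width<p P cover between with shared-crossing width<p P between
  ... | a , b , shared , ab-crosses with cover a b shared
  ...   | inj₁ ab∈L = (a , b) , ab∈L , ab-crosses
  ...   | inj₂ ba∈L = (b , a) , ba∈L , Crosses-sym ab-crosses

open Crossings using (Crosses; Crosses-level; covered-crossing)

module _ {n m p} {s t : Vertex n m} (m<p : m < p) (n<p : n < p) (P : Fin p → Path s t)
         {L : List (Vertex n m × Vertex n m)} (cover : Covers P L) where

  private
    Boundary : Set
    Boundary = Fin ∣ X s - X t ∣ ⊎ Fin ∣ Y s - Y t ∣

    Rung : Boundary → Vertex n m × Vertex n m → Set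
    Rung (inj₁ j) = Crosses columns (X s ⊓ X t + toℕ j)
    Rung (inj₂ j) = Crosses rows (Y s ⊓ Y t + toℕ j)

    rung : ∀ r → ∃[ e ] e ∈ L × Rung r e
    rung (inj₁ j) = covered-crossing columns m<p P cover (between-⊓+ (X s) (X t) (toℕ<n j))
    rung (inj₂ j) = covered-crossing rows n<p P cover (between-⊓+ (Y s) (Y t) (toℕ<n j))

    -- Column rungs join different columns, row rungs join vertices of the same column.
    Rung-injective : ∀ {r r′ e} → Rung r e → Rung r′ e → r ≡ r′
    Rung-injective {inj₁ _} {inj₁ _} ρ ρ′ = cong inj₁ (toℕ-injective (+-cancelˡ-≡ _ _ _ (Crosses-level columns ρ ρ′)))
    Rung-injective {inj₂ _} {inj₂ _} ρ ρ′ = cong inj₂ (toℕ-injective (+-cancelˡ-≡ _ _ _ (Crosses-level rows ρ ρ′)))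
    Rung-injective {inj₁ _} {inj₂ _} (_ , different-X , _) (_ , _ , same-X) = contradiction (cong toℕ same-X) different-X
    Rung-injective {inj₂ _} {inj₁ _} (_ , _ , same-X) (_ , different-X , _) = contradiction (cong toℕ same-X) different-X

    boundary : Fin (manhattan s t) → Boundary
    boundary = splitAt ∣ X s - X t ∣

    edgeAt : Fin (manhattan s t) → Vertex n m × Vertex n m
    edgeAt i = proj₁ (rung (boundary i))

    edgeAt-injective : Injective _≡_ _≡_ edgeAt
    edgeAt-injective {i} {j} eq = splitAt-injective ∣ X s - X t ∣
      (Rung-injective (proj₂ (proj₂ (rung (boundary i))))
                      (subst (Rung (boundary j)) (sym eq) (proj₂ (proj₂ (rung (boundary j))))))

  manhattan≤cover : manhattan s t ≤ length L
  manhattan≤cover = injective-into-list edgeAt (λ i → proj₁ (proj₂ (rung (boundary i)))) edgeAt-injective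

lemma1 : (n m : ℕ) (s t : Vertex n m) (p k : ℕ) → s ≢ t → m < p → n < p →
    (d : ℕ) → IsDist s t d →
    (MSESolvable n m s t p k → d ≤ k) × (d ≤ k → MSESolvable n m s t p k)
lemma1 n m s t p k _ m<p n<p d ((shortest , len≡d) , minimal) =
  (λ { (P , L , L≤k , cover) → ≤-trans (dist≤manhattan minimal) (≤-trans (manhattan≤cover m<p n<p P cover) L≤k) }) ,
  (λ d≤k → copies-solvable p shortest (subst (_≤ k) (sym len≡d) d≤k))
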